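{- Let $C_a$ and $C_b$ be comparator networks on $n$ channels and $\pi$ a permutation of $\{1,\dots,n\}$. If $\pi(\mathsf{outputs}(C_a))\subseteq\mathsf{outputs}(C_b)$, then $\pi(w(C_a,x,k))\subseteq w(C_b,x,k)$ for all $x\in\{0,1\}$ and $1\le k\le n$.
   Context: A comparator network on $n$ channels is a sequence of comparators $(i,j)$, $1\le i<j\le n$; on input $\vec x\in\{0,1\}^n$ each comparator swaps positions $i,j$ if $x_i>x_j$, applied in order, giving output $C(\vec x)$; $\mathsf{outputs}(C)=\{C(\vec x):\vec x\in\{0,1\}^n\}$. A permutation $\pi$ of $\{1,\dots,n\}$ acts on a vector $\vec x$ by moving entry $i$ to position $\pi(i)$ (i.e. $(\pi(\vec x))_{\pi(i)}=x_i$), on sets of vectors elementwise, and on sets of positions by $\pi(W)=\{\pi(i):i\in W\}$. For a comparator network $C$, $x\in\{0,1\}$ and $0\le k\le n$, $w(C,x,k)$ is the set of positions $i$ such that there exists a vector $x_1\ldots x_n\in\mathsf{outputs}(C)$ containing exactly $k$ ones with $x_i=x$. -}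

module Defs where

open import Data.Nat using (ℕ; _<_)
open import Data.Bool using (Bool; true; false; _∧_; _∨_)
open import Data.Fin using (Fin; toℕ; _≟_)
open import Data.Fin.Permutation using (Permutation′; _⟨$⟩ʳ_; _⟨$⟩ˡ_)
open import Data.Vec using (Vec; lookup; tabulate; countᵇ)
open import Data.List using (List; []; _∷_)
open import Data.Product using (Σ; _×_; ∃)
open import Relation.Binary.PropositionalEquality using (_≡_)
open import Relation.Nullary using (does)
open import Function using (id)

-- Channels are Fin n (0-based: channel i here is channel i+1 of the paper).
-- A 0/1 vector is a Vec Bool n (false = 0, true = 1).

record Comparator (n : ℕ) : Set where
  constructor comp
  field
    i j : Fin n
    i<j : toℕ i < toℕ j

Network : ℕ → Set
Network n = List (Comparator n)

-- Apply one comparator: position i gets min(x_i,x_j), position j gets max(x_i,x_j);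
-- this is exactly "swap if x_i > x_j" on 0/1 values.
applyComparator : ∀ {n} → Comparator n → Vec Bool n → Vec Bool n
applyComparator {n} (comp i j _) x = tabulate f
  where
    f : Fin n → Bool
    f k with does (k ≟ i) | does (k ≟ j)
    ... | true  | _     = lookup x i ∧ lookup x j
    ... | false | true  = lookup x i ∨ lookup x j
    ... | false | false = lookup x k

run : ∀ {n} → Network n → Vec Bool n → Vec Bool n
run []       x = x
run (c ∷ cs) x = run cs (applyComparator c x)

outputs : ∀ {n} → Network n → Vec Bool n → Set
outputs C y = ∃ λ x → run C x ≡ y

permVec : ∀ {n} → Permutation′ n → Vec Bool n → Vec Bool n
permVec π x = tabulate (λ k → lookup x (π ⟨$⟩ˡ k))

permSet : ∀ {n} → Permutation′ n → (Vec Bool n → Set) → (Vec Bool n → Set)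
permSet π S y = ∃ λ x → S x × permVec π x ≡ y

permPos : ∀ {n} → Permutation′ n → (Fin n → Set) → (Fin n → Set)
permPos π W j = ∃ λ i → W i × π ⟨$⟩ʳ i ≡ j

ones : ∀ {n} → Vec Bool n → ℕ
ones = countᵇ id

w : ∀ {n} → Network n → Bool → ℕ → Fin n → Set
w C x k i = ∃ λ y → outputs C y × ones y ≡ k × lookup y i ≡ x

_⊆_ : ∀ {A : Set} → (A → Set) → (A → Set) → Set
S ⊆ T = ∀ a → S a → T a

-- Outputs of C_a are carried by π to outputs of C_b; moving entries around preserves the
-- number of ones, and the entry at position i of y lands at position π(i) of π(y).

module Submission where

open import Defs
open import Data.Nat using (ℕ; _≤_; suc)
open import Data.Nat.Properties using (+-0-commutativeMonoid)
open import Data.Bool using (Bool; true; false)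
open import Data.Fin using (Fin)
open import Data.Fin.Permutation using (Permutation′; _⟨$⟩ʳ_; _⟨$⟩ˡ_; flip; inverseˡ)
open import Data.Vec using (Vec; []; _∷_; lookup)
open import Data.Vec.Properties using (lookup∘tabulate)
open import Data.Product using (_,_)
open import Relation.Binary.PropositionalEquality using (_≡_; refl; sym; trans; cong; module ≡-Reasoning)
open import Algebra.Properties.CommutativeMonoid.Sum +-0-commutativeMonoid using (sum; sum-cong-≗; sum-permute)

boolToℕ : Bool → ℕ
boolToℕ true  = 1
boolToℕ false = 0

ones≡sum : ∀ {n} (y : Vec Bool n) → ones y ≡ sum (λ i → boolToℕ (lookup y i))
ones≡sum []          = refl
ones≡sum (true ∷ y)  = cong suc (ones≡sum y)
ones≡sum (false ∷ y) = ones≡sum y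

lookup-permVec : ∀ {n} (π : Permutation′ n) (y : Vec Bool n) i →
                 lookup (permVec π y) i ≡ lookup y (π ⟨$⟩ˡ i)
lookup-permVec π y = lookup∘tabulate (λ j → lookup y (π ⟨$⟩ˡ j))

lookup-permVec-image : ∀ {n} (π : Permutation′ n) (y : Vec Bool n) i →
                       lookup (permVec π y) (π ⟨$⟩ʳ i) ≡ lookup y i
lookup-permVec-image π y i = trans (lookup-permVec π y (π ⟨$⟩ʳ i)) (cong (lookup y) (inverseˡ π))

ones-permVec : ∀ {n} (π : Permutation′ n) (y : Vec Bool n) → ones (permVec π y) ≡ ones y
ones-permVec π y = begin
  ones (permVec π y)
    ≡⟨ ones≡sum (permVec π y) ⟩
  sum (λ i → boolToℕ (lookup (permVec π y) i))
    ≡⟨ sum-cong-≗ (λ i → cong boolToℕ (lookup-permVec π y i)) ⟩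
  sum (λ i → boolToℕ (lookup y (π ⟨$⟩ˡ i)))
    ≡⟨ sum-permute (λ i → boolToℕ (lookup y i)) (flip π) ⟨
  sum (λ i → boolToℕ (lookup y i))
    ≡⟨ ones≡sum y ⟨
  ones y
    ∎
  where open ≡-Reasoning

lemma6 : ∀ (n : ℕ) (Ca Cb : Network n) (π : Permutation′ n) →
    permSet π (outputs Ca) ⊆ outputs Cb →
    ∀ (x : Bool) (k : ℕ) → 1 ≤ k → k ≤ n →
    permPos π (w Ca x k) ⊆ w Cb x k
lemma6 n Ca Cb π outputs⊆ x k _ _ .(π ⟨$⟩ʳ i) (i , (y , y∈outputs , ones-y , y-i) , refl) =
  permVec π y ,
  outputs⊆ (permVec π y) (y , y∈outputs , refl) ,
  trans (ones-permVec π y) ones-y ,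
  trans (lookup-permVec-image π y i) y-i
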